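{- Let $(y_n)_{n\ge1}$ be a constant sequence $y_n=j$ for a fixed positive integer $j$. Then $\lim_{n\to\infty}T(n)=1$, and hence $\lim_{n\to\infty}M(n)=\lim_{n\to\infty}S(n)=0$.
   Context: For a nondecreasing sequence $(y_n)_{n\ge1}$ of positive integers and a positive integer $n$, an $n$-tuple $(x_1,\dots,x_n)$ of nonnegative integers is valid if $x_1\le y_n$ and $x_{j+1}\le\min(x_j,y_{n-j})$ for $1\le j\le n-1$. $A(n,k)$ is the number of valid $n$-tuples with $x_1=k$, and $W(n)=\sum_{k=0}^{y_n}A(n,k)$. For $n\ge3$ define $$T(n)=\frac{(1+y_n-y_{n-1})W(n-1)}{W(n)},\qquad M(n)=\frac{\sum_{k=1}^{(y_{n-1}-y_{n-2})+1}\big(W(n-1)-kW(n-2)\big)}{W(n)},\qquad S(n)=1-M(n)-T(n).$$ -}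

module Defs where

open import Data.Bool using (Bool; true; false; _∧_)
open import Data.Nat using (ℕ; zero; suc; _+_; _*_; _∸_; _≤ᵇ_; _≡ᵇ_; _≤_)
open import Data.Integer as ℤ using (ℤ)
open import Data.List using (List; []; _∷_; [_]; map; concatMap; upTo; filter; length)
open import Data.Nat.ListAction using (sum)
open import Data.Vec using (Vec; []; _∷_)
open import Data.Rational as ℚ using (ℚ; 0ℚ; 1ℚ; _/_; _<_; ∣_∣)
open import Data.Product using (∃)
open import Relation.Nullary.Decidable using (Dec)
open import Data.Bool.Properties using (T?)
open import Data.Bool using (T)

-- A sequence (y_n)_{n≥1} is modelled as y : ℕ → ℕ (the value y 0 is never used).

-- Chain condition on the tail: `okTail y n prev i rest` checks, for the tail
-- rest = (x_{i+1}, …, x_n) following prev = x_i, that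
-- x_{m+1} ≤ min(x_m, y_{n-m}) for every m ≥ i.
okTail : (ℕ → ℕ) → ℕ → ℕ → ℕ → ∀ {m} → Vec ℕ m → Bool
okTail y n prev i [] = true
okTail y n prev i (x ∷ xs) = (x ≤ᵇ prev) ∧ (x ≤ᵇ y (n ∸ i)) ∧ okTail y n x (suc i) xs

valid : (ℕ → ℕ) → (n : ℕ) → Vec ℕ n → Bool
valid y n [] = true
valid y n (x ∷ xs) = (x ≤ᵇ y n) ∧ okTail y n x 1 xs

firstIs : ℕ → ∀ {n} → Vec ℕ n → Bool
firstIs k [] = false
firstIs k (x ∷ _) = x ≡ᵇ k

tuples : (n b : ℕ) → List (Vec ℕ n)
tuples zero b = [ [] ]
tuples (suc n) b = concatMap (λ x → map (x ∷_) (tuples n b)) (upTo (suc b))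

-- A(n,k): number of valid n-tuples with x_1 = k.  Every entry of a valid
-- tuple is ≤ x_1 ≤ y_n, so enumerating tuples with entries ≤ y_n is exhaustive.
A : (ℕ → ℕ) → ℕ → ℕ → ℕ
A y n k = length (filter (λ v → T? (valid y n v ∧ firstIs k v)) (tuples n (y n)))

W : (ℕ → ℕ) → ℕ → ℕ
W y n = sum (map (A y n) (upTo (suc (y n))))

-- a / d as a rational, with the convention a / 0 = 0 (never triggered: W(n) ≥ 1).
ratio : ℤ → ℕ → ℚ
ratio a zero = 0ℚ
ratio a (suc d) = a / suc d

Tn : (ℕ → ℕ) → ℕ → ℚ
Tn y n = ratio (ℤ.+ ((1 + (y n ∸ y (n ∸ 1))) * W y (n ∸ 1))) (W y n)

Mn : (ℕ → ℕ) → ℕ → ℚ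
Mn y n = ratio (sumZ (map term (map suc (upTo ((y (n ∸ 1) ∸ y (n ∸ 2)) + 1))))) (W y n)
  where
  term : ℕ → ℤ
  term k = ℤ.+ (W y (n ∸ 1)) ℤ.- ℤ.+ (k * W y (n ∸ 2))
  sumZ : List ℤ → ℤ
  sumZ [] = ℤ.0ℤ
  sumZ (z ∷ zs) = z ℤ.+ sumZ zs

Sn : (ℕ → ℕ) → ℕ → ℚ
Sn y n = (1ℚ ℚ.- Mn y n) ℚ.- Tn y n

ConvergesTo : (ℕ → ℚ) → ℚ → Set
ConvergesTo f L = ∀ (ε : ℚ) → 0ℚ < ε → ∃ λ N → ∀ n → N ≤ n → ∣ f n ℚ.- L ∣ < ε

{-# OPTIONS --safe #-}
-- For a constant sequence y ≡ j the bound x_{i+1} ≤ y_{n-i} is implied by x_{i+1} ≤ x_i ≤ x_1 ≤ j, so a valid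
-- n-tuple is just a nonincreasing tuple with entries ≤ j and W(n) = (n + j choose n). Hence n W(n) = (n + j) W(n-1), i.e.
-- W(n) − W(n-1) = j W(n-1) / n ≤ j W(n) / n. As y_n − y_{n-1} = 0, T(n) − 1 = −(W(n) − W(n-1)) / W(n),
-- M(n) = (W(n-1) − W(n-2)) / W(n) (a single summand) and S(n) = (1 − T(n)) − M(n) are all O(1/n).
module Submission where

open import Data.Bool using (Bool; true; false; _∧_)
open import Data.Bool.Properties using (T?; ∧-zeroʳ; ∧-identityʳ)
open import Data.Integer as ℤ using (ℤ; +[1+_]; -[1+_])
import Data.Integer.Properties as ℤP
import Data.Integer.Solver as ℤSolver
open import Data.List using (List; []; _∷_; [_]; _++_; map; concatMap; filter; length; upTo)
open import Data.List.Properties using (map-++; map-cong; upTo-∷ʳ)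
open import Data.Nat
open import Data.Nat.ListAction using (sum)
open import Data.Nat.ListAction.Properties using (sum-++)
open import Data.Nat.Properties
import Data.Nat.Solver as ℕSolver
open import Data.Product using (_×_; _,_; ∃₂)
open import Data.Sum using (inj₁; inj₂)
open import Data.Rational as ℚ using (ℚ; mkℚ; 0ℚ; 1ℚ; toℚᵘ; ↧ₙ_)
import Data.Rational.Properties as ℚP
import Data.Rational.Solver as ℚSolver
open import Data.Rational.Unnormalised as ℚᵘ using (mkℚᵘ; *≡*; *<*)
import Data.Rational.Unnormalised.Properties as ℚᵘP
open import Data.Vec using (Vec; _∷_)
open import Function using (_∘_)
open import Relation.Binary.PropositionalEquality using (_≡_; _≢_; refl; sym; trans; cong; cong₂; subst; subst₂; module ≡-Reasoning)
open import Relation.Nullary.Decidable using (dec-true; dec-false)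

open import Defs

private variable
  X Y : Set

indicator : Bool → ℕ
indicator true  = 1
indicator false = 0

count : (X → Bool) → List X → ℕ
count p []       = 0
count p (x ∷ xs) = indicator (p x) + count p xs

length-filter-T? : (p : X → Bool) (xs : List X) → length (filter (T? ∘ p) xs) ≡ count p xs
length-filter-T? p [] = refl
length-filter-T? p (x ∷ xs) with p x
... | true  = cong suc (length-filter-T? p xs)
... | false = length-filter-T? p xs

count-cong : {p q : X → Bool} → (∀ x → p x ≡ q x) → (xs : List X) → count p xs ≡ count q xs
count-cong p≗q []       = refl
count-cong p≗q (x ∷ xs) = cong₂ _+_ (cong indicator (p≗q x)) (count-cong p≗q xs)

count-none : {p : X → Bool} → (∀ x → p x ≡ false) → (xs : List X) → count p xs ≡ 0
count-none p≗false []       = refl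
count-none p≗false (x ∷ xs) rewrite p≗false x = count-none p≗false xs

count-++ : (p : X → Bool) (xs ys : List X) → count p (xs ++ ys) ≡ count p xs + count p ys
count-++ p []       ys = refl
count-++ p (x ∷ xs) ys = trans (cong (indicator (p x) +_) (count-++ p xs ys)) (sym (+-assoc (indicator (p x)) _ _))

count-map : (p : Y → Bool) (f : X → Y) (xs : List X) → count p (map f xs) ≡ count (p ∘ f) xs
count-map p f []       = refl
count-map p f (x ∷ xs) = cong (indicator (p (f x)) +_) (count-map p f xs)

count-concatMap : (p : Y → Bool) (F : X → List Y) (xs : List X) →
                  count p (concatMap F xs) ≡ sum (map (count p ∘ F) xs)
count-concatMap p F []       = refl
count-concatMap p F (x ∷ xs) = trans (count-++ p (F x) (concatMap F xs)) (cong (count p (F x) +_) (count-concatMap p F xs))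

sum< : (ℕ → ℕ) → ℕ → ℕ
sum< g zero    = 0
sum< g (suc n) = sum< g n + g n

sum-map-upTo : ∀ g n → sum (map g (upTo n)) ≡ sum< g n
sum-map-upTo g zero    = refl
sum-map-upTo g (suc n) = begin
  sum (map g (upTo (suc n)))           ≡⟨ cong (sum ∘ map g) (upTo-∷ʳ n) ⟨
  sum (map g (upTo n ++ [ n ]))        ≡⟨ cong sum (map-++ g (upTo n) [ n ]) ⟩
  sum (map g (upTo n) ++ [ g n ])      ≡⟨ sum-++ (map g (upTo n)) [ g n ] ⟩
  sum (map g (upTo n)) + (g n + 0)     ≡⟨ cong₂ _+_ (sum-map-upTo g n) (+-identityʳ (g n)) ⟩
  sum< g (suc n)                       ∎
  where open ≡-Reasoning

sum<-cong : ∀ {g h} n → (∀ x → x < n → g x ≡ h x) → sum< g n ≡ sum< h n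
sum<-cong zero    g≗h = refl
sum<-cong (suc n) g≗h = cong₂ _+_ (sum<-cong n (λ x x<n → g≗h x (m<n⇒m<1+n x<n))) (g≗h n ≤-refl)

sum<-truncate : ∀ {g b n} → b ≤ n → (∀ x → b ≤ x → x < n → g x ≡ 0) → sum< g n ≡ sum< g b
sum<-truncate {n = zero}  z≤n  vanish = refl
sum<-truncate {g} {b} {suc n} b≤1+n vanish with m≤n⇒m<n∨m≡n b≤1+n
... | inj₂ refl = refl
... | inj₁ b<1+n = begin
  sum< g n + g n  ≡⟨ cong₂ _+_ (sum<-truncate b≤n (λ x b≤x x<n → vanish x b≤x (m<n⇒m<1+n x<n))) (vanish n b≤n ≤-refl) ⟩
  sum< g b + 0    ≡⟨ +-identityʳ _ ⟩
  sum< g b        ∎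
  where
  open ≡-Reasoning
  b≤n : b ≤ n
  b≤n = ≤-pred b<1+n

sum<-single : ∀ {g k n} → k < n → (∀ x → x < n → x ≢ k → g x ≡ 0) → sum< g n ≡ g k
sum<-single {g} {k} {n} k<n vanish = begin
  sum< g n         ≡⟨ sum<-truncate k<n (λ x k<x x<n → vanish x x<n (>⇒≢ k<x)) ⟩
  sum< g k + g k   ≡⟨ cong (_+ g k) (sum<-truncate z≤n (λ x _ x<k → vanish x (<-trans x<k k<n) (<⇒≢ x<k))) ⟩
  g k              ∎
  where open ≡-Reasoning

count-tuples-suc : ∀ m (p : Vec ℕ (suc m) → Bool) b →
                   count p (tuples (suc m) b) ≡ sum< (λ x → count (p ∘ (x ∷_)) (tuples m b)) (suc b)
count-tuples-suc m p b = begin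
  count p (concatMap (λ x → map (x ∷_) (tuples m b)) (upTo (suc b)))
    ≡⟨ count-concatMap p (λ x → map (x ∷_) (tuples m b)) (upTo (suc b)) ⟩
  sum (map (λ x → count p (map (x ∷_) (tuples m b))) (upTo (suc b)))
    ≡⟨ cong sum (map-cong (λ x → count-map p (x ∷_) (tuples m b)) (upTo (suc b))) ⟩
  sum (map (λ x → count (p ∘ (x ∷_)) (tuples m b)) (upTo (suc b)))
    ≡⟨ sum-map-upTo _ (suc b) ⟩
  sum< (λ x → count (p ∘ (x ∷_)) (tuples m b)) (suc b) ∎
  where open ≡-Reasoning

-- chains m b counts the nonincreasing m-tuples with entries ≤ b; it equals the binomial (m + b choose m).
chains : ℕ → ℕ → ℕ
chains zero    b = 1
chains (suc m) b = sum< (chains m) (suc b)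

chains-zeroʳ : ∀ m → chains m 0 ≡ 1
chains-zeroʳ zero    = refl
chains-zeroʳ (suc m) = chains-zeroʳ m

chains-positive : ∀ m b → 1 ≤ chains m b
chains-positive zero    b = ≤-refl
chains-positive (suc m) b = ≤-trans (chains-positive m b) (m≤n+m _ _)

chains-factorial : ∀ m b → chains m b * (m ! * b !) ≡ (m + b) !
chains-factorial zero    b = trans (+-identityʳ _) (+-identityʳ _)
chains-factorial (suc m) zero rewrite chains-zeroʳ m | +-identityʳ m = trans (+-identityʳ _) (*-identityʳ _)
chains-factorial (suc m) (suc b) = begin
  (P + Q) * (suc m ! * suc b !)
    ≡⟨ solve 6 (λ m b P Q fm fb → (P :+ Q) :* (((con 1 :+ m) :* fm) :* ((con 1 :+ b) :* fb))
                 := (con 1 :+ b) :* (P :* (((con 1 :+ m) :* fm) :* fb)) :+ (con 1 :+ m) :* (Q :* (fm :* ((con 1 :+ b) :* fb))))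
               refl m b P Q (m !) (b !) ⟩
  suc b * (P * (suc m ! * b !)) + suc m * (Q * (m ! * suc b !))
    ≡⟨ cong₂ (λ u v → suc b * u + suc m * v) (chains-factorial (suc m) b) (chains-factorial m (suc b)) ⟩
  suc b * (suc m + b) ! + suc m * (m + suc b) !
    ≡⟨ cong (λ k → suc b * (suc m + b) ! + suc m * k !) (+-suc m b) ⟩
  suc b * K + suc m * K
    ≡⟨ solve 3 (λ m b K → (con 1 :+ b) :* K :+ (con 1 :+ m) :* K := (con 2 :+ m :+ b) :* K) refl m b K ⟩
  suc (suc (m + b)) * K
    ≡⟨ cong (λ k → suc k * k !) (+-suc m b) ⟨
  (suc m + suc b) ! ∎
  where
  open ≡-Reasoning
  open ℕSolver.+-*-Solver
  P Q K : ℕ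
  P = chains (suc m) b
  Q = chains m (suc b)
  K = suc (m + b) !

chains-recurrence : ∀ m b → suc m * chains (suc m) b ≡ (suc m + b) * chains m b
chains-recurrence m b = *-cancelʳ-≡ _ _ (m ! * b !) {{m !* b !≢0}} (begin
  suc m * C₁ * (m ! * b !)        ≡⟨ solve 4 (λ m C₁ fm fb → (con 1 :+ m) :* C₁ :* (fm :* fb) := C₁ :* (((con 1 :+ m) :* fm) :* fb))
                                        refl m C₁ (m !) (b !) ⟩
  C₁ * (suc m ! * b !)            ≡⟨ chains-factorial (suc m) b ⟩
  suc (m + b) * (m + b) !         ≡⟨ cong (suc (m + b) *_) (chains-factorial m b) ⟨
  suc (m + b) * (C₀ * (m ! * b !)) ≡⟨ *-assoc (suc (m + b)) C₀ _ ⟨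
  (suc m + b) * C₀ * (m ! * b !)  ∎)
  where
  open ≡-Reasoning
  open ℕSolver.+-*-Solver
  C₁ C₀ : ℕ
  C₁ = chains (suc m) b
  C₀ = chains m b

scaled-< : ∀ {m z c d e p} → m * z ≤ c * suc d → c * suc e < m → z * suc e < suc p * suc d
scaled-< {m} {z} {c} {d} {e} {p} mz≤cD cE<m = *-cancelˡ-< m _ _ (begin-strict
  m * (z * suc e)     ≡⟨ *-assoc m z (suc e) ⟨
  m * z * suc e       ≤⟨ *-monoˡ-≤ (suc e) mz≤cD ⟩
  c * suc d * suc e   ≡⟨ solve 3 (λ c d e → c :* d :* e := c :* e :* d) refl c (suc d) (suc e) ⟩
  c * suc e * suc d   <⟨ *-monoˡ-< (suc d) cE<m ⟩
  m * suc d           ≤⟨ *-monoʳ-≤ m (m≤n*m (suc d) (suc p)) ⟩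
  m * (suc p * suc d) ∎)
  where
  open ≤-Reasoning
  open ℕSolver.+-*-Solver

∣∣<-of-bound : ∀ {q z d c m} (ε : ℚ) → 0ℚ ℚ.< ε → toℚᵘ q ℚᵘ.≃ mkℚᵘ z d →
               m * ℤ.∣ z ∣ ≤ c * suc d → c * ↧ₙ ε < m → ℚ.∣ q ∣ ℚ.< ε
∣∣<-of-bound {q} {z} {d} {c} (mkℚ +[1+ p ] e _) _ q≃z/d mz≤cD cε<m =
  ℚP.toℚᵘ-cancel-< (ℚᵘP.<-respˡ-≃ ∣z∣/d≃∣q∣ (*<* (subst₂ ℤ._<_ (ℤP.pos-* ℤ.∣ z ∣ (suc e)) (ℤP.pos-* (suc p) (suc d))
    (ℤ.+<+ (scaled-< {c = c} {p = p} mz≤cD cε<m)))))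
  where
  ∣z∣/d≃∣q∣ : mkℚᵘ (ℤ.+ ℤ.∣ z ∣) d ℚᵘ.≃ toℚᵘ ℚ.∣ q ∣
  ∣z∣/d≃∣q∣ = ℚᵘP.≃-sym (ℚᵘP.≃-trans (ℚP.toℚᵘ-homo-∣-∣ q) (ℚᵘP.∣-∣-cong q≃z/d))
∣∣<-of-bound (mkℚ (ℤ.+ zero) _ _) (ℚ.*<* (ℤ.+<+ ())) _ _ _
∣∣<-of-bound (mkℚ -[1+ _ ] _ _) (ℚ.*<* ()) _ _ _

DeviationBound : (ℕ → ℚ) → ℚ → ℕ → ℕ → Set
DeviationBound g L k c = ∀ m → ∃₂ λ z d → toℚᵘ (g (k + m) ℚ.- L) ℚᵘ.≃ mkℚᵘ z d × m * ℤ.∣ z ∣ ≤ c * suc d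

convergesTo-of-deviationBound : ∀ g L k c → DeviationBound g L k c → ConvergesTo g L
convergesTo-of-deviationBound g L k c bound ε 0<ε = k + suc (c * ↧ₙ ε) , close
  where
  close : ∀ n → k + suc (c * ↧ₙ ε) ≤ n → ℚ.∣ g n ℚ.- L ∣ ℚ.< ε
  close n N≤n with m≤n⇒∃[o]m+o≡n (≤-trans (m≤m+n k (suc (c * ↧ₙ ε))) N≤n)
  ... | m , refl with bound m
  ... | z , d , g≃z/d , mz≤cD = ∣∣<-of-bound {c = c} ε 0<ε g≃z/d mz≤cD (+-cancelˡ-≤ k _ _ N≤n)

toℚᵘ-homo-− : ∀ p q → toℚᵘ (p ℚ.- q) ℚᵘ.≃ toℚᵘ p ℚᵘ.- toℚᵘ q
toℚᵘ-homo-− p q = ℚᵘP.≃-trans (ℚP.toℚᵘ-homo-+ p (ℚ.- q)) (ℚᵘP.+-congʳ (toℚᵘ p) (ℚP.toℚᵘ-homo‿- q))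

toℚᵘ-ratio : ∀ z d → toℚᵘ (ratio z (suc d)) ℚᵘ.≃ mkℚᵘ z d
toℚᵘ-ratio z d = ℚP.toℚᵘ-fromℚᵘ (mkℚᵘ z d)

toℚᵘ-1≃ : ∀ d → toℚᵘ 1ℚ ℚᵘ.≃ mkℚᵘ (ℤ.+ suc d) d
toℚᵘ-1≃ d = *≡* (ℤP.*-comm (ℤ.+ 1) (ℤ.+ suc d))

fraction-− : ∀ p q d → mkℚᵘ p d ℚᵘ.- mkℚᵘ q d ℚᵘ.≃ mkℚᵘ (p ℤ.- q) d
fraction-− p q d = *≡* (begin
  (p ℤ.* D ℤ.+ ℤ.- q ℤ.* D) ℤ.* D    ≡⟨ solve 3 (λ p q D → (p :* D :+ :- q :* D) :* D := (p :- q) :* (D :* D)) refl p q D ⟩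
  (p ℤ.- q) ℤ.* (D ℤ.* D)            ≡⟨ cong ((p ℤ.- q) ℤ.*_) (ℤP.pos-* (suc d) (suc d)) ⟨
  (p ℤ.- q) ℤ.* ℤ.+ (suc d * suc d)  ∎)
  where
  open ≡-Reasoning
  open ℤSolver.+-*-Solver
  D : ℤ
  D = ℤ.+ suc d

ratio-−1 : ∀ {a} b {{_ : NonZero a}} → b ≤ a → toℚᵘ (ratio (ℤ.+ b) a ℚ.- 1ℚ) ℚᵘ.≃ mkℚᵘ (ℤ.- ℤ.+ (a ∸ b)) (pred a)
ratio-−1 {suc d} b b≤a = begin
  toℚᵘ (ratio (ℤ.+ b) (suc d) ℚ.- 1ℚ)             ≈⟨ toℚᵘ-homo-− (ratio (ℤ.+ b) (suc d)) 1ℚ ⟩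
  toℚᵘ (ratio (ℤ.+ b) (suc d)) ℚᵘ.- toℚᵘ 1ℚ       ≈⟨ ℚᵘP.+-cong (toℚᵘ-ratio (ℤ.+ b) d) (ℚᵘP.-‿cong (toℚᵘ-1≃ d)) ⟩
  mkℚᵘ (ℤ.+ b) d ℚᵘ.- mkℚᵘ (ℤ.+ suc d) d         ≈⟨ fraction-− (ℤ.+ b) (ℤ.+ suc d) d ⟩
  mkℚᵘ (ℤ.+ b ℤ.- ℤ.+ suc d) d                    ≡⟨ cong (λ z → mkℚᵘ z d) b−a≡−[a∸b] ⟩
  mkℚᵘ (ℤ.- ℤ.+ (suc d ∸ b)) d                    ∎
  where
  open ℚᵘP.≃-Reasoning
  b−a≡−[a∸b] : ℤ.+ b ℤ.- ℤ.+ suc d ≡ ℤ.- ℤ.+ (suc d ∸ b)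
  b−a≡−[a∸b] = trans (ℤP.m-n≡m⊖n b (suc d)) (trans (ℤP.⊖-swap b (suc d)) (cong ℤ.-_ (ℤP.⊖-≥ b≤a)))

ratio-−0 : ∀ {a} z {{_ : NonZero a}} → toℚᵘ (ratio z a ℚ.- 0ℚ) ℚᵘ.≃ mkℚᵘ z (pred a)
ratio-−0 {suc d} z = ℚᵘP.≃-trans (ℚᵘP.≃-reflexive (cong toℚᵘ (ℚP.+-identityʳ (ratio z (suc d))))) (toℚᵘ-ratio z d)

complement-deviation : ∀ p q → ((1ℚ ℚ.- p) ℚ.- q) ℚ.- 0ℚ ≡ ℚ.- (q ℚ.- 1ℚ) ℚ.- (p ℚ.- 0ℚ)
complement-deviation = solve 2 (λ p q → ((con 1ℚ :- p) :- q) :- con 0ℚ := (:- (q :- con 1ℚ)) :- (p :- con 0ℚ)) refl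
  where open ℚSolver.+-*-Solver

module ConstantSequence (j : ℕ) where

  y : ℕ → ℕ
  y _ = j

  count-okTail : ∀ m n i b → b ≤ j → count (okTail y n b i) (tuples m j) ≡ chains m b
  count-okTail zero    n i b b≤j = refl
  count-okTail (suc m) n i b b≤j = begin
    count (okTail y n b i) (tuples (suc m) j)  ≡⟨ count-tuples-suc m (okTail y n b i) j ⟩
    sum< step (suc j)                          ≡⟨ sum<-truncate (s≤s b≤j) beyond ⟩
    sum< step (suc b)                          ≡⟨ sum<-cong (suc b) (λ x x<1+b → below x (≤-pred x<1+b)) ⟩
    sum< (chains m) (suc b)                    ∎
    where
    open ≡-Reasoning
    step : ℕ → ℕ
    step x = count (okTail y n b i ∘ (x ∷_)) (tuples m j)
    rest : ℕ → Vec ℕ m → Bool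
    rest x v = (x ≤ᵇ j) ∧ okTail y n x (suc i) v
    beyond : ∀ x → suc b ≤ x → x < suc j → step x ≡ 0
    beyond x b<x _ = count-none (λ v → cong (_∧ rest x v) (dec-false (x ≤? b) (<⇒≱ b<x))) (tuples m j)
    below : ∀ x → x ≤ b → step x ≡ chains m x
    below x x≤b = trans
      (count-cong (λ v → cong₂ (λ u w → u ∧ (w ∧ okTail y n x (suc i) v)) (dec-true (x ≤? b) x≤b) (dec-true (x ≤? j) x≤j))
                  (tuples m j))
      (count-okTail m n (suc i) x x≤j)
      where
      x≤j : x ≤ j
      x≤j = ≤-trans x≤b b≤j

  A-const : ∀ m k → k ≤ j → A y (suc m) k ≡ chains m k
  A-const m k k≤j = begin
    A y (suc m) k                         ≡⟨ length-filter-T? P (tuples (suc m) j) ⟩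
    count P (tuples (suc m) j)            ≡⟨ count-tuples-suc m P j ⟩
    sum< step (suc j)                     ≡⟨ sum<-single (s≤s k≤j) others ⟩
    step k                                ≡⟨ count-cong first (tuples m j) ⟩
    count (okTail y (suc m) k 1) (tuples m j) ≡⟨ count-okTail m (suc m) 1 k k≤j ⟩
    chains m k                            ∎
    where
    open ≡-Reasoning
    P : Vec ℕ (suc m) → Bool
    P v = valid y (suc m) v ∧ firstIs k v
    step : ℕ → ℕ
    step x = count (P ∘ (x ∷_)) (tuples m j)
    others : ∀ x → x < suc j → x ≢ k → step x ≡ 0
    others x _ x≢k = count-none
      (λ v → trans (cong (valid y (suc m) (x ∷ v) ∧_) (dec-false (x ≟ k) x≢k)) (∧-zeroʳ _)) (tuples m j)
    first : ∀ v → P (k ∷ v) ≡ okTail y (suc m) k 1 v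
    first v = trans (cong₂ (λ u w → (u ∧ okTail y (suc m) k 1 v) ∧ w) (dec-true (k ≤? j) k≤j) (dec-true (k ≟ k) refl))
                    (∧-identityʳ _)

  W-const : ∀ m → W y (suc m) ≡ chains (suc m) j
  W-const m = trans (sum-map-upTo (A y (suc m)) (suc j)) (sum<-cong (suc j) (λ k k<1+j → A-const m k (≤-pred k<1+j)))

  W-positive : ∀ m → 1 ≤ W y (suc m)
  W-positive m = subst (1 ≤_) (sym (W-const m)) (chains-positive (suc m) j)

  W-nonZero : ∀ m → NonZero (W y (suc m))
  W-nonZero m = >-nonZero (W-positive m)

  W-recurrence : ∀ m → suc (suc m) * W y (2 + m) ≡ (suc (suc m) + j) * W y (suc m)
  W-recurrence m rewrite W-const m | W-const (suc m) = chains-recurrence (suc m) j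

  W-monotone : ∀ m → W y (suc m) ≤ W y (2 + m)
  W-monotone m = *-cancelˡ-≤ (2 + m) (begin
    (2 + m) * W y (suc m)        ≤⟨ *-monoˡ-≤ (W y (suc m)) (m≤m+n (2 + m) j) ⟩
    (2 + m + j) * W y (suc m)    ≡⟨ W-recurrence m ⟨
    (2 + m) * W y (2 + m)        ∎)
    where open ≤-Reasoning

  W-increment : ∀ m → (2 + m) * (W y (2 + m) ∸ W y (suc m)) ≡ j * W y (suc m)
  W-increment m = begin
    (2 + m) * (W y (2 + m) ∸ W y (suc m))              ≡⟨ *-distribˡ-∸ (2 + m) (W y (2 + m)) (W y (suc m)) ⟩
    (2 + m) * W y (2 + m) ∸ (2 + m) * W y (suc m)      ≡⟨ cong (_∸ (2 + m) * W y (suc m)) (W-recurrence m) ⟩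
    (2 + m + j) * W y (suc m) ∸ (2 + m) * W y (suc m)  ≡⟨ cong (_∸ (2 + m) * W y (suc m)) (*-distribʳ-+ (W y (suc m)) (2 + m) j) ⟩
    (2 + m) * W y (suc m) + j * W y (suc m) ∸ (2 + m) * W y (suc m)
                                                       ≡⟨ m+n∸m≡n ((2 + m) * W y (suc m)) (j * W y (suc m)) ⟩
    j * W y (suc m)                                    ∎
    where open ≡-Reasoning

  W-increment-bound : ∀ m k → k ≤ 2 + m → k * (W y (2 + m) ∸ W y (suc m)) ≤ j * W y (2 + m)
  W-increment-bound m k k≤2+m = begin
    k * (W y (2 + m) ∸ W y (suc m))        ≤⟨ *-monoˡ-≤ _ k≤2+m ⟩
    (2 + m) * (W y (2 + m) ∸ W y (suc m))  ≡⟨ W-increment m ⟩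
    j * W y (suc m)                        ≤⟨ *-monoʳ-≤ j (W-monotone m) ⟩
    j * W y (2 + m)                        ∎
    where open ≤-Reasoning

  Tn-const : ∀ m → Tn y (3 + m) ≡ ratio (ℤ.+ W y (2 + m)) (W y (3 + m))
  Tn-const m = cong (λ t → ratio (ℤ.+ t) (W y (3 + m)))
    (trans (cong (λ e → (1 + e) * W y (2 + m)) (n∸n≡0 j)) (*-identityˡ (W y (2 + m))))

  Mn-const : ∀ m → Mn y (3 + m) ≡ ratio (ℤ.+ (W y (2 + m) ∸ W y (suc m))) (W y (3 + m))
  Mn-const m = trans unfold (cong (λ z → ratio z (W y (3 + m))) numerator)
    where
    b c : ℕ
    b = W y (2 + m)
    c = W y (suc m)
    unfold : Mn y (3 + m) ≡ ratio ((ℤ.+ b ℤ.- ℤ.+ (1 * c)) ℤ.+ ℤ.0ℤ) (W y (3 + m))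
    unfold rewrite n∸n≡0 j = refl
    numerator : (ℤ.+ b ℤ.- ℤ.+ (1 * c)) ℤ.+ ℤ.0ℤ ≡ ℤ.+ (b ∸ c)
    numerator = begin
      (ℤ.+ b ℤ.- ℤ.+ (1 * c)) ℤ.+ ℤ.0ℤ  ≡⟨ ℤP.+-identityʳ _ ⟩
      ℤ.+ b ℤ.- ℤ.+ (1 * c)             ≡⟨ cong (λ t → ℤ.+ b ℤ.- ℤ.+ t) (*-identityˡ c) ⟩
      ℤ.+ b ℤ.- ℤ.+ c                   ≡⟨ ℤP.m-n≡m⊖n b c ⟩
      b ℤ.⊖ c                           ≡⟨ ℤP.⊖-≥ (W-monotone m) ⟩
      ℤ.+ (b ∸ c)                       ∎
      where open ≡-Reasoning

  predW : ℕ → ℕ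
  predW m = pred (W y (3 + m))

  suc-predW : ∀ m → suc (predW m) ≡ W y (3 + m)
  suc-predW m = suc-pred (W y (3 + m)) {{W-nonZero (2 + m)}}

  T-fraction : ∀ m → toℚᵘ (Tn y (3 + m) ℚ.- 1ℚ) ℚᵘ.≃ mkℚᵘ (ℤ.- ℤ.+ (W y (3 + m) ∸ W y (2 + m))) (predW m)
  T-fraction m = ℚᵘP.≃-trans (ℚᵘP.≃-reflexive (cong (λ t → toℚᵘ (t ℚ.- 1ℚ)) (Tn-const m)))
                             (ratio-−1 (W y (2 + m)) {{W-nonZero (2 + m)}} (W-monotone (suc m)))

  M-fraction : ∀ m → toℚᵘ (Mn y (3 + m) ℚ.- 0ℚ) ℚᵘ.≃ mkℚᵘ (ℤ.+ (W y (2 + m) ∸ W y (suc m))) (predW m)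
  M-fraction m = ℚᵘP.≃-trans (ℚᵘP.≃-reflexive (cong (λ t → toℚᵘ (t ℚ.- 0ℚ)) (Mn-const m)))
                             (ratio-−0 (ℤ.+ (W y (2 + m) ∸ W y (suc m))) {{W-nonZero (2 + m)}})

  T-bound : ∀ m → m * (W y (3 + m) ∸ W y (2 + m)) ≤ j * suc (predW m)
  T-bound m rewrite suc-predW m = W-increment-bound (suc m) m (m≤n+m m 3)

  M-bound : ∀ m → m * (W y (2 + m) ∸ W y (suc m)) ≤ j * suc (predW m)
  M-bound m rewrite suc-predW m = ≤-trans (W-increment-bound m m (m≤n+m m 2)) (*-monoʳ-≤ j (W-monotone (suc m)))

  T-deviation : DeviationBound (Tn y) 1ℚ 3 j
  T-deviation m = _ , predW m , T-fraction m ,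
    subst (λ t → m * t ≤ j * suc (predW m)) (sym (ℤP.∣-i∣≡∣i∣ (ℤ.+ _))) (T-bound m)

  M-deviation : DeviationBound (Mn y) 0ℚ 3 j
  M-deviation m = _ , predW m , M-fraction m , M-bound m

  S-deviation : DeviationBound (Sn y) 0ℚ 3 (j + j)
  S-deviation m = ℤ.- zT ℤ.- zM , predW m , S-fraction , S-bound
    where
    k₁ k₂ : ℕ
    k₁ = W y (3 + m) ∸ W y (2 + m)
    k₂ = W y (2 + m) ∸ W y (suc m)
    zT zM : ℤ
    zT = ℤ.- ℤ.+ k₁
    zM = ℤ.+ k₂
    S-fraction : toℚᵘ (Sn y (3 + m) ℚ.- 0ℚ) ℚᵘ.≃ mkℚᵘ (ℤ.- zT ℤ.- zM) (predW m)
    S-fraction = begin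
      toℚᵘ (Sn y (3 + m) ℚ.- 0ℚ)
        ≡⟨ cong toℚᵘ (complement-deviation (Mn y (3 + m)) (Tn y (3 + m))) ⟩
      toℚᵘ (ℚ.- (Tn y (3 + m) ℚ.- 1ℚ) ℚ.- (Mn y (3 + m) ℚ.- 0ℚ))
        ≈⟨ toℚᵘ-homo-− (ℚ.- (Tn y (3 + m) ℚ.- 1ℚ)) (Mn y (3 + m) ℚ.- 0ℚ) ⟩
      toℚᵘ (ℚ.- (Tn y (3 + m) ℚ.- 1ℚ)) ℚᵘ.- toℚᵘ (Mn y (3 + m) ℚ.- 0ℚ)
        ≈⟨ ℚᵘP.+-cong (ℚᵘP.≃-trans (ℚP.toℚᵘ-homo‿- _) (ℚᵘP.-‿cong (T-fraction m))) (ℚᵘP.-‿cong (M-fraction m)) ⟩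
      mkℚᵘ (ℤ.- zT) (predW m) ℚᵘ.- mkℚᵘ zM (predW m)
        ≈⟨ fraction-− (ℤ.- zT) zM (predW m) ⟩
      mkℚᵘ (ℤ.- zT ℤ.- zM) (predW m) ∎
      where open ℚᵘP.≃-Reasoning
    S-bound : m * ℤ.∣ ℤ.- zT ℤ.- zM ∣ ≤ (j + j) * suc (predW m)
    S-bound = begin
      m * ℤ.∣ ℤ.- zT ℤ.- zM ∣                ≤⟨ *-monoʳ-≤ m (ℤP.∣i-j∣≤∣i∣+∣j∣ (ℤ.- zT) zM) ⟩
      m * (ℤ.∣ ℤ.- zT ∣ + k₂)               ≡⟨ cong (λ t → m * (ℤ.∣ t ∣ + k₂)) (ℤP.neg-involutive (ℤ.+ k₁)) ⟩
      m * (k₁ + k₂)                         ≡⟨ *-distribˡ-+ m k₁ k₂ ⟩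
      m * k₁ + m * k₂                       ≤⟨ +-mono-≤ (T-bound m) (M-bound m) ⟩
      j * suc (predW m) + j * suc (predW m) ≡⟨ *-distribʳ-+ (suc (predW m)) j j ⟨
      (j + j) * suc (predW m)               ∎
      where open ≤-Reasoning

proposition6p5 : (j : ℕ) → 1 Data.Nat.≤ j →
    ConvergesTo (Tn (λ _ → j)) 1ℚ ×
    ConvergesTo (Mn (λ _ → j)) 0ℚ ×
    ConvergesTo (Sn (λ _ → j)) 0ℚ
proposition6p5 j _ =
    convergesTo-of-deviationBound (Tn y) 1ℚ 3 j T-deviation
  , convergesTo-of-deviationBound (Mn y) 0ℚ 3 j M-deviation
  , convergesTo-of-deviationBound (Sn y) 0ℚ 3 (j + j) S-deviation
  where open ConstantSequence j
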